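{- For every odd integer $t\ge1$, $$h(1)\,h[-1]^t\mathbf{1}=\sum_{k\ge0}\binom{t}{2k+1}\frac{(2k+1)!}{k!(-24)^k}\,h(-1)^{t-2k-1}\mathbf{1}.$$
   Context: $S_{\mathrm{alg}}=\mathbb{Q}[h(-1),h(-2),\dots]$ (any field of characteristic zero) is the rank-one Heisenberg vertex operator algebra with vacuum $\mathbf{1}=1$: for $n<0$, $h(n)$ acts by multiplication, for $n\ge1$, $h(n)$ acts as $n\,\partial/\partial h(-n)$, and $h(0)$ acts as $0$. The square-bracket modes are $h[n]=\mathrm{Res}_z\, z^n e^z\sum_{m\in\mathbb{Z}}h(m)(e^z-1)^{ -m-1}$, with $(e^z-1)^{ -m-1}$ expanded as a Laurent series in $z$. In particular $h[-1]=\sum_{k\ge0}c_k h(k-1)$ where $c_k$ is the coefficient of $w^{k-1}$ in $(\log(1+w))^{ -1}$, i.e. $h[-1]=h(-1)+\frac12h(0)-\frac1{12}h(1)+\frac1{24}h(2)-\cdots$. -}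

module Defs where

open import Data.Nat as ℕ using (ℕ; zero; suc; _⊔_; _!)
open import Data.Nat.Properties using (m*n≢0; m^n≢0; _!≢0)
open import Data.Nat.Combinatorics using (_C_)
open import Data.Integer as ℤ using (ℤ; +_; -[1+_])
open import Data.Rational as ℚ using (ℚ; _/_)
open import Data.List using (List; []; _∷_; map; concatMap; foldr; upTo; length; zipWith; sum)
open import Data.List.Properties using (≡-dec)
open import Data.Product using (_×_; _,_)
open import Data.Bool using (Bool; true; false; if_then_else_)
open import Relation.Nullary.Decidable using (⌊_⌋)
open import Relation.Binary.PropositionalEquality using (_≡_)

-- The Heisenberg VOA  S_alg = ℚ[h(-1), h(-2), ...].
-- A monomial is an exponent list  [e₁, e₂, …]  meaning  ∏ h(-i)^{eᵢ}
-- (position i-1 of the list is the exponent of h(-i); missing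
-- trailing entries are 0).

Mono : Set
Mono = List ℕ

Poly : Set
Poly = List (ℚ × Mono)

vac : Poly
vac = (ℚ.1ℚ , []) ∷ []

_⊕_ : Poly → Poly → Poly
p ⊕ q = Data.List._++_ p q

scale : ℚ → Poly → Poly
scale c = map (λ { (a , m) → (c ℚ.* a , m) })

Σp : List Poly → Poly
Σp = foldr _⊕_ []

expAt : ℕ → Mono → ℕ
expAt _       []       = 0
expAt zero    (e ∷ _)  = e
expAt (suc j) (_ ∷ m)  = expAt j m

incAt : ℕ → Mono → Mono
incAt zero    []       = 1 ∷ []
incAt zero    (e ∷ m)  = suc e ∷ m
incAt (suc j) []       = 0 ∷ incAt j []
incAt (suc j) (e ∷ m)  = e ∷ incAt j m

decAt : ℕ → Mono → Mono
decAt _       []       = []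
decAt zero    (e ∷ m)  = ℕ.pred e ∷ m
decAt (suc j) (e ∷ m)  = e ∷ decAt j m

-- multiplication by h(-i), i = suc j
mulVar : ℕ → Poly → Poly
mulVar j = map (λ { (a , m) → (a , incAt j m) })

-- ∂/∂h(-i), i = suc j
deriv : ℕ → Poly → Poly
deriv j = concatMap (λ { (a , m) → (((+ (expAt j m)) / 1) ℚ.* a , decAt j m) ∷ [] })

-- the Heisenberg modes  h(n):
--   n < 0 : multiplication by h(n);  n = 0 : 0;  n ≥ 1 : n ∂/∂h(-n)
hmode : ℤ → Poly → Poly
hmode (+ zero)    p = []
hmode (+ suc j)   p = scale (((+ (suc j)) / 1)) (deriv j p)
hmode (-[1+ j ])  p = mulVar j p

-- Coefficients c_k of w^{k-1} in (log(1+w))^{-1}.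
-- log(1+w) = w · L(w),  L(w) = Σ_j a_j w^j,  a_j = (-1)^j/(j+1),
-- so (log(1+w))^{-1} = w^{-1} · L(w)^{-1} and c_k = b_k where
-- Σ b_k w^k is the multiplicative inverse of L(w) (a₀ = 1):
--   b₀ = 1,   b_{n+1} = - Σ_{j=1}^{n+1} a_j b_{n+1-j}.

logCoeff : ℕ → ℚ
logCoeff j = ((-[1+ 0 ]) ℤ.^ j) / suc j

-- revB n = [b_n , b_{n-1} , … , b_0]
revB : ℕ → List ℚ
revB zero    = ℚ.1ℚ ∷ []
revB (suc n) = bn1 ∷ bs
  where
  bs  = revB n
  bn1 = ℚ.- foldr ℚ._+_ ℚ.0ℚ (zipWith ℚ._*_ (map (λ i → logCoeff (suc i)) (upTo (suc n))) bs)

headQ : List ℚ → ℚ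
headQ []      = ℚ.0ℚ
headQ (x ∷ _) = x

c : ℕ → ℚ
c k = headQ (revB k)

-- h[-1] = Σ_{k ≥ 0} c_k h(k-1).  On a given polynomial only finitely
-- many terms are nonzero: h(k-1) kills p as soon as k-1 exceeds every
-- variable index occurring in p.  We sum over k = 0 .. N+1 where N
-- bounds the variable indices occurring in p (the omitted terms are 0).

maxLen : Poly → ℕ
maxLen = foldr (λ { (_ , m) n → length m ⊔ n }) 0

hBr-1 : Poly → Poly
hBr-1 p = Σp (map (λ k → scale (c k) (hmode (+ k ℤ.- + 1) p)) (upTo (maxLen p ℕ.+ 2)))

hBr-1^ : ℕ → Poly → Poly
hBr-1^ zero    p = p
hBr-1^ (suc t) p = hBr-1 (hBr-1^ t p)

-- Equality in S_alg: equal coefficients of every monomial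
-- (monomials compared after removing trailing zero exponents).

trim : Mono → Mono
trim []      = []
trim (e ∷ m) with trim m
... | []     = if ⌊ e ℕ.≟ 0 ⌋ then [] else (e ∷ [])
... | r      = e ∷ r

coeff : Poly → Mono → ℚ
coeff p m = foldr (λ { (a , m') s → (if ⌊ ≡-dec ℕ._≟_ (trim m') (trim m) ⌋ then a else ℚ.0ℚ) ℚ.+ s }) ℚ.0ℚ p

_≈P_ : Poly → Poly → Set
p ≈P q = ∀ m → coeff p m ≡ coeff q m

-- Right-hand side:  Σ_{k ≥ 0} C(t,2k+1) (2k+1)! / (k! (-24)^k) · h(-1)^{t-2k-1} 1.
-- (Terms with 2k+1 > t vanish since C(t,2k+1) = 0; so k ranges over 0..t.)
-- The rational number (2k+1)!/(k!(-24)^k) is written as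
-- (-1)^k (2k+1)! / (k! · 24^k).

rhsCoeff : ℕ → ℕ → ℚ
rhsCoeff t k = ((+ ((t C (1 ℕ.+ 2 ℕ.* k)) ℕ.* (1 ℕ.+ 2 ℕ.* k) !)) ℤ.* ((-[1+ 0 ]) ℤ.^ k)) / (k ! ℕ.* 24 ℕ.^ k)
  where instance
    _ = m*n≢0 (k !) (24 ℕ.^ k) {{k !≢0}} {{m^n≢0 24 k}}

h-1^ : ℕ → Poly
h-1^ n = (ℚ.1ℚ , n ∷ []) ∷ []

rhs : ℕ → Poly
rhs t = Σp (map (λ k → scale (rhsCoeff t k) (h-1^ (t ℕ.∸ (1 ℕ.+ 2 ℕ.* k)))) (upTo (suc t)))

-- Every polynomial reached from 1 by h[-1] lies in ℚ[h(-1)], on which h(0) = 0 and h(j) = 0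
-- for j ≥ 2, so h[-1] acts there as h(-1) + c₂ h(1) with c₂ = -1/12 = 2r, r = -1/24; writing
-- x = h(-1), this is x + 2r d/dx on ℚ[x].  The coefficient a(t,n) of xⁿ in h[-1]ᵗ 1 therefore
-- satisfies a(t+1,n+1) = a(t,n) + 2r(n+2) a(t,n+2) and a(t+1,0) = 2r a(t,1), which forces
-- a(t,n) = 0 unless t = n + 2k, and a(n+2k,n) = (n+2k)!/(n! k!) rᵏ.  Applying h(1) = d/dx, the
-- coefficient of xⁿ on the left is (n+1) a(t,n+1) = t!/(n! k!) rᵏ for t = n+1+2k, which is the
-- k-th term C(t,2k+1) (2k+1)!/(k! (-24)ᵏ) on the right; every other term on either side is 0.

module Submission where

open import Defs
open import Data.Nat using (ℕ; _%_)
open import Data.Integer using (+_)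
open import Relation.Binary.PropositionalEquality using (_≡_)

open import Data.Bool using (true; false; if_then_else_)
open import Data.Empty using (⊥-elim)
open import Data.Integer as ℤ using (-[1+_])
import Data.Integer.Properties as ℤP
import Data.Integer.Tactic.RingSolver as ℤ-Solver
open import Data.List using ([]; _∷_; map; applyUpTo; upTo)
open import Data.List.Properties using (≡-dec)
open import Data.List.Relation.Unary.All using (All; []; _∷_)
import Data.List.Relation.Unary.All.Properties as All
open import Data.Nat as ℕ using (zero; suc; NonZero; _!)
open import Data.Nat.Combinatorics using (_C_; nCk≡n!/k![n-k]!; k![n∸k]!∣n!; k>n⇒nCk≡0)
open import Data.Nat.DivMod using (m/n*n≡m)
open import Data.Nat.Properties as ℕP using (anyUpTo?)
import Data.Nat.Tactic.RingSolver as ℕ-Solver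
open import Data.Product using (_,_; proj₂)
open import Data.Rational as ℚ using (ℚ; _/_; 0ℚ; 1ℚ)
import Data.Rational.Properties as ℚP
open import Algebra.Definitions.RawSemiring ℚP.+-*-rawSemiring using (_^_)
open import Data.Rational.Solver using (module +-*-Solver)
import Data.Rational.Unnormalised as ℚᵘ
import Data.Rational.Unnormalised.Properties as ℚᵘP
open import Function using (_∘_; id)
open import Function.Bundles using (mk⇔)
open import Relation.Binary.PropositionalEquality
  using (_≢_; refl; sym; trans; cong; cong₂; subst; module ≡-Reasoning)
open import Relation.Nullary using (yes; no)
open import Relation.Nullary.Decidable using (does; ⌊_⌋; isYes≗does; does-⇔; dec-true; dec-false)

open ≡-Reasoning

fromℕ : ℕ → ℚ
fromℕ n = + n / 1

/-≡ : ∀ a b c d .{{_ : NonZero b}} .{{_ : NonZero d}} → a ℤ.* + d ≡ c ℤ.* + b → a / b ≡ c / d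
/-≡ a (suc b) c (suc d) eq = ℚP.fromℚᵘ-cong {ℚᵘ.mkℚᵘ a b} {ℚᵘ.mkℚᵘ c d} (ℚᵘ.*≡* eq)

/-*-/ : ∀ a b c d .{{_ : NonZero b}} .{{_ : NonZero d}} →
        (a / b) ℚ.* (c / d) ≡ ((a ℤ.* c) / (b ℕ.* d)) {{ℕP.m*n≢0 b d}}
/-*-/ a (suc b) c (suc d) = ℚP.toℚᵘ-injective (ℚᵘP.≃-trans (ℚP.toℚᵘ-homo-* (a / suc b) (c / suc d))
  (ℚᵘP.≃-trans (ℚᵘP.*-cong (ℚP.toℚᵘ-fromℚᵘ (ℚᵘ.mkℚᵘ a b)) (ℚP.toℚᵘ-fromℚᵘ (ℚᵘ.mkℚᵘ c d)))
    (ℚᵘP.≃-sym (ℚP.toℚᵘ-fromℚᵘ (ℚᵘ.mkℚᵘ (a ℤ.* c) (ℕ.pred (suc b ℕ.* suc d)))))))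

/-+-/ : ∀ a b c d .{{_ : NonZero b}} .{{_ : NonZero d}} →
        (a / b) ℚ.+ (c / d) ≡ ((a ℤ.* + d ℤ.+ c ℤ.* + b) / (b ℕ.* d)) {{ℕP.m*n≢0 b d}}
/-+-/ a (suc b) c (suc d) = ℚP.toℚᵘ-injective (ℚᵘP.≃-trans (ℚP.toℚᵘ-homo-+ (a / suc b) (c / suc d))
  (ℚᵘP.≃-trans (ℚᵘP.+-cong (ℚP.toℚᵘ-fromℚᵘ (ℚᵘ.mkℚᵘ a b)) (ℚP.toℚᵘ-fromℚᵘ (ℚᵘ.mkℚᵘ c d)))
    (ℚᵘP.≃-sym (ℚP.toℚᵘ-fromℚᵘ (ℚᵘ.mkℚᵘ (a ℤ.* + suc d ℤ.+ c ℤ.* + suc b) (ℕ.pred (suc b ℕ.* suc d)))))))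

fromℕ-+ : ∀ m n → fromℕ (m ℕ.+ n) ≡ fromℕ m ℚ.+ fromℕ n
fromℕ-+ m n = sym (trans (/-+-/ (+ m) 1 (+ n) 1) (cong (_/ 1) (begin
  + m ℤ.* + 1 ℤ.+ + n ℤ.* + 1   ≡⟨ cong₂ ℤ._+_ (ℤP.*-identityʳ (+ m)) (ℤP.*-identityʳ (+ n)) ⟩
  + m ℤ.+ + n                   ≡⟨ ℤP.pos-+ m n ⟨
  + (m ℕ.+ n)                   ∎)))

fromℕ-* : ∀ m n → fromℕ (m ℕ.* n) ≡ fromℕ m ℚ.* fromℕ n
fromℕ-* m n = sym (trans (/-*-/ (+ m) 1 (+ n) 1) (cong (_/ 1) (sym (ℤP.pos-* m n))))

fromℕ-*-/ : ∀ a s d .{{_ : NonZero d}} → fromℕ a ℚ.* (s / d) ≡ (+ a ℤ.* s) / d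
fromℕ-*-/ a s d =
  trans (/-*-/ (+ a) 1 s d) (ℚP./-cong {+ a ℤ.* s} {1 ℕ.* d} {+ a ℤ.* s} {d} {{ℕP.m*n≢0 1 d}} refl (ℕP.*-identityˡ d))

/-cancel : ∀ a e s d .{{_ : NonZero d}} .{{_ : NonZero (e ℕ.* d)}} →
           (+ (a ℕ.* e) ℤ.* s) / (e ℕ.* d) ≡ (+ a ℤ.* s) / d
/-cancel a e s d = /-≡ (+ (a ℕ.* e) ℤ.* s) (e ℕ.* d) (+ a ℤ.* s) d (begin
  + (a ℕ.* e) ℤ.* s ℤ.* + d          ≡⟨ cong (λ x → x ℤ.* s ℤ.* + d) (ℤP.pos-* a e) ⟩
  + a ℤ.* + e ℤ.* s ℤ.* + d          ≡⟨ regroup (+ a) (+ e) s (+ d) ⟩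
  + a ℤ.* s ℤ.* (+ e ℤ.* + d)        ≡⟨ cong (+ a ℤ.* s ℤ.*_) (ℤP.pos-* e d) ⟨
  + a ℤ.* s ℤ.* + (e ℕ.* d)          ∎)
  where
  regroup : ∀ x y s z → x ℤ.* y ℤ.* s ℤ.* z ≡ x ℤ.* s ℤ.* (y ℤ.* z)
  regroup = ℤ-Solver.solve-∀

termCoeff : ℚ → Mono → Mono → ℚ
termCoeff a m′ m = if ⌊ ≡-dec ℕ._≟_ (trim m′) (trim m) ⌋ then a else 0ℚ

coeff-⊕ : ∀ p q m → coeff (p ⊕ q) m ≡ coeff p m ℚ.+ coeff q m
coeff-⊕ []             q m = sym (ℚP.+-identityˡ (coeff q m))
coeff-⊕ ((a , m′) ∷ p) q m =
  trans (cong (t ℚ.+_) (coeff-⊕ p q m)) (sym (ℚP.+-assoc t (coeff p m) (coeff q m)))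
  where t = termCoeff a m′ m

coeff-scale : ∀ b p m → coeff (scale b p) m ≡ b ℚ.* coeff p m
coeff-scale b []             m = sym (ℚP.*-zeroʳ b)
coeff-scale b ((a , m′) ∷ p) m =
  trans (cong₂ ℚ._+_ termCoeff-* (coeff-scale b p m)) (sym (ℚP.*-distribˡ-+ b (termCoeff a m′ m) (coeff p m)))
  where
  termCoeff-* : termCoeff (b ℚ.* a) m′ m ≡ b ℚ.* termCoeff a m′ m
  termCoeff-* with ⌊ ≡-dec ℕ._≟_ (trim m′) (trim m) ⌋
  ... | true  = refl
  ... | false = sym (ℚP.*-zeroʳ b)

coeff-Σp-vanish : ∀ (F : ℕ → Poly) (f : ℕ → ℕ) N m → (∀ i → coeff (F (f i)) m ≡ 0ℚ) →
                  coeff (Σp (map F (applyUpTo f N))) m ≡ 0ℚ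
coeff-Σp-vanish F f zero    m vanish = refl
coeff-Σp-vanish F f (suc N) m vanish = begin
  coeff (F (f 0) ⊕ rest) m               ≡⟨ coeff-⊕ (F (f 0)) rest m ⟩
  coeff (F (f 0)) m ℚ.+ coeff rest m     ≡⟨ cong₂ ℚ._+_ (vanish 0) (coeff-Σp-vanish F (f ∘ suc) N m (vanish ∘ suc)) ⟩
  0ℚ                                     ∎
  where rest = Σp (map F (applyUpTo (f ∘ suc) N))

coeff-Σp-single : ∀ (F : ℕ → Poly) (f : ℕ → ℕ) N m i → i ℕ.< N → (∀ k → k ≢ i → coeff (F (f k)) m ≡ 0ℚ) →
                  coeff (Σp (map F (applyUpTo f N))) m ≡ coeff (F (f i)) m
coeff-Σp-single F f (suc N) m zero _ vanish = begin
  coeff (F (f 0) ⊕ rest) m               ≡⟨ coeff-⊕ (F (f 0)) rest m ⟩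
  coeff (F (f 0)) m ℚ.+ coeff rest m     ≡⟨ cong (coeff (F (f 0)) m ℚ.+_) (coeff-Σp-vanish F (f ∘ suc) N m (λ k → vanish (suc k) λ ())) ⟩
  coeff (F (f 0)) m ℚ.+ 0ℚ               ≡⟨ ℚP.+-identityʳ (coeff (F (f 0)) m) ⟩
  coeff (F (f 0)) m                      ∎
  where rest = Σp (map F (applyUpTo (f ∘ suc) N))
coeff-Σp-single F f (suc N) m (suc i) (ℕ.s≤s i<N) vanish = begin
  coeff (F (f 0) ⊕ rest) m               ≡⟨ coeff-⊕ (F (f 0)) rest m ⟩
  coeff (F (f 0)) m ℚ.+ coeff rest m     ≡⟨ cong₂ ℚ._+_ (vanish 0 λ ()) (coeff-Σp-single F (f ∘ suc) N m i i<N vanish′) ⟩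
  0ℚ ℚ.+ coeff (F (f (suc i))) m         ≡⟨ ℚP.+-identityˡ (coeff (F (f (suc i))) m) ⟩
  coeff (F (f (suc i))) m                ∎
  where
  rest = Σp (map F (applyUpTo (f ∘ suc) N))
  vanish′ : ∀ k → k ≢ i → coeff (F (f (suc k))) m ≡ 0ℚ
  vanish′ k k≢i = vanish (suc k) (k≢i ∘ ℕP.suc-injective)

data Univariateᵐ : Mono → Set where
  const : Univariateᵐ []
  pow   : ∀ e → Univariateᵐ (e ∷ [])

Univariate : Poly → Set
Univariate = All (Univariateᵐ ∘ proj₂)

expAt₀-trim : ∀ m → expAt 0 (trim m) ≡ expAt 0 m
expAt₀-trim []      = refl
expAt₀-trim (e ∷ m) with trim m
expAt₀-trim (zero  ∷ m) | [] = refl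
expAt₀-trim (suc e ∷ m) | [] = refl
... | _ ∷ _ = refl

trim-univariate : ∀ {m} → Univariateᵐ m → trim m ≡ trim (expAt 0 m ∷ [])
trim-univariate const   = refl
trim-univariate (pow e) = refl

trim₁-injective : ∀ {a b} → trim (a ∷ []) ≡ trim (b ∷ []) → a ≡ b
trim₁-injective {a} {b} eq = trans (sym (expAt₀-trim (a ∷ []))) (trans (cong (expAt 0) eq) (expAt₀-trim (b ∷ [])))

coeff-trim-cong : ∀ p m m′ → trim m ≡ trim m′ → coeff p m ≡ coeff p m′
coeff-trim-cong []              m m′ eq = refl
coeff-trim-cong ((a , m″) ∷ p) m m′ eq =
  cong₂ ℚ._+_ (cong (λ z → if ⌊ ≡-dec ℕ._≟_ (trim m″) z ⌋ then a else 0ℚ) eq) (coeff-trim-cong p m m′ eq)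

coeff-off-axis : ∀ {p} m → Univariate p → trim m ≢ trim (expAt 0 m ∷ []) → coeff p m ≡ 0ℚ
coeff-off-axis                m []       off = refl
coeff-off-axis {(a , m′) ∷ p} m (u ∷ us) off =
  trans (cong (ℚ._+ coeff p m) termCoeff-off) (trans (ℚP.+-identityˡ (coeff p m)) (coeff-off-axis m us off))
  where
  termCoeff-off : termCoeff a m′ m ≡ 0ℚ
  termCoeff-off with ≡-dec ℕ._≟_ (trim m′) (trim m)
  ... | no _   = refl
  ... | yes eq = ⊥-elim (off (begin
    trim m                   ≡⟨ sym eq ⟩
    trim m′                  ≡⟨ trim-univariate u ⟩
    trim (expAt 0 m′ ∷ [])   ≡⟨ cong (λ e → trim (e ∷ [])) same-exponent ⟩
    trim (expAt 0 m ∷ [])    ∎))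
    where
    same-exponent : expAt 0 m′ ≡ expAt 0 m
    same-exponent = trans (sym (expAt₀-trim m′)) (trans (cong (expAt 0) eq) (expAt₀-trim m))

coeff₁ : Poly → ℕ → ℚ
coeff₁ p n = coeff p (n ∷ [])

univariate-≈P : ∀ {p q} → Univariate p → Univariate q → (∀ n → coeff₁ p n ≡ coeff₁ q n) → p ≈P q
univariate-≈P {p} {q} up uq eq m with ≡-dec ℕ._≟_ (trim m) (trim (expAt 0 m ∷ []))
... | yes on  = trans (coeff-trim-cong p m (expAt 0 m ∷ []) on)
                      (trans (eq (expAt 0 m)) (sym (coeff-trim-cong q m (expAt 0 m ∷ []) on)))
... | no off = trans (coeff-off-axis m up off) (sym (coeff-off-axis m uq off))

δ : ℕ → ℕ → ℚ → ℚ
δ e n a = if does (e ℕ.≟ n) then a else 0ℚ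

δ-zero : ∀ e n → δ e n 0ℚ ≡ 0ℚ
δ-zero e n with does (e ℕ.≟ n)
... | true  = refl
... | false = refl

δ-refl : ∀ e a → δ e e a ≡ a
δ-refl e a rewrite dec-true (e ℕ.≟ e) refl = refl

δ-≢ : ∀ {e n} a → e ≢ n → δ e n a ≡ 0ℚ
δ-≢ {e} {n} a e≢n rewrite dec-false (e ℕ.≟ n) e≢n = refl

δ-pred : ∀ e n a → δ (ℕ.pred e) n (fromℕ e ℚ.* a) ≡ fromℕ (suc n) ℚ.* δ e (suc n) a
δ-pred zero n a = begin
  δ 0 n (0ℚ ℚ.* a)       ≡⟨ cong (δ 0 n) (ℚP.*-zeroˡ a) ⟩
  δ 0 n 0ℚ               ≡⟨ δ-zero 0 n ⟩
  0ℚ                     ≡⟨ ℚP.*-zeroʳ (fromℕ (suc n)) ⟨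
  fromℕ (suc n) ℚ.* 0ℚ   ∎
δ-pred (suc e) n a with e ℕ.≟ n
... | yes refl = trans (δ-refl e (fromℕ (suc e) ℚ.* a)) (cong (fromℕ (suc e) ℚ.*_) (sym (δ-refl e a)))
... | no e≢n  = trans (δ-≢ (fromℕ (suc e) ℚ.* a) e≢n)
                      (sym (trans (cong (fromℕ (suc n) ℚ.*_) (δ-≢ a e≢n)) (ℚP.*-zeroʳ (fromℕ (suc n)))))

coeff₁-∷ : ∀ {a m} p n → Univariateᵐ m → coeff₁ ((a , m) ∷ p) n ≡ δ (expAt 0 m) n a ℚ.+ coeff₁ p n
coeff₁-∷ {a} {m} p n u =
  cong (λ b → (if b then a else 0ℚ) ℚ.+ coeff₁ p n) (trans (isYes≗does on?) (does-⇔ (mk⇔ to from) on? (expAt 0 m ℕ.≟ n)))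
  where
  on? = ≡-dec ℕ._≟_ (trim m) (trim (n ∷ []))
  to : trim m ≡ trim (n ∷ []) → expAt 0 m ≡ n
  to eq = trim₁-injective (trans (sym (trim-univariate u)) eq)
  from : expAt 0 m ≡ n → trim m ≡ trim (n ∷ [])
  from eq = trans (trim-univariate u) (cong (λ e → trim (e ∷ [])) eq)

incAt₀-univariate : ∀ {m} → Univariateᵐ m → Univariateᵐ (incAt 0 m)
incAt₀-univariate const   = pow 1
incAt₀-univariate (pow e) = pow (suc e)

decAt-univariate : ∀ j {m} → Univariateᵐ m → Univariateᵐ (decAt j m)
decAt-univariate j       const   = const
decAt-univariate zero    (pow e) = pow (ℕ.pred e)
decAt-univariate (suc j) (pow e) = pow e

expAt₀-incAt₀ : ∀ m → expAt 0 (incAt 0 m) ≡ suc (expAt 0 m)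
expAt₀-incAt₀ []      = refl
expAt₀-incAt₀ (e ∷ m) = refl

expAt₀-decAt₀ : ∀ m → expAt 0 (decAt 0 m) ≡ ℕ.pred (expAt 0 m)
expAt₀-decAt₀ []      = refl
expAt₀-decAt₀ (e ∷ m) = refl

expAt-suc-univariate : ∀ j {m} → Univariateᵐ m → expAt (suc j) m ≡ 0
expAt-suc-univariate j const   = refl
expAt-suc-univariate j (pow e) = refl

univariate-scale : ∀ a {p} → Univariate p → Univariate (scale a p)
univariate-scale a = All.map⁺

univariate-h-1 : ∀ {p} → Univariate p → Univariate (hmode -[1+ 0 ] p)
univariate-h-1 = All.gmap⁺ incAt₀-univariate

univariate-deriv : ∀ j {p} → Univariate p → Univariate (deriv j p)
univariate-deriv j []       = []
univariate-deriv j (u ∷ us) = decAt-univariate j u ∷ univariate-deriv j us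

univariate-h+ : ∀ k {p} → Univariate p → Univariate (hmode (+ k) p)
univariate-h+ zero    u = []
univariate-h+ (suc j) u = univariate-scale (fromℕ (suc j)) (univariate-deriv j u)

univariate-Σp : ∀ {F : ℕ → Poly} → (∀ k → Univariate (F k)) → ∀ ks → Univariate (Σp (map F ks))
univariate-Σp uF []       = []
univariate-Σp uF (k ∷ ks) = All.++⁺ (uF k) (univariate-Σp uF ks)

bracketTerm : Poly → ℕ → Poly
bracketTerm p k = scale (c k) (hmode (+ k ℤ.- + 1) p)

univariate-hBr-1 : ∀ {p} → Univariate p → Univariate (hBr-1 p)
univariate-hBr-1 {p} u = univariate-Σp {bracketTerm p} term (upTo (maxLen p ℕ.+ 2))
  where
  term : ∀ k → Univariate (bracketTerm p k)
  term zero    = univariate-scale (c 0) (univariate-h-1 u)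
  term (suc k) = univariate-scale (c (suc k)) (univariate-h+ k u)

univariate-hBr-1^ : ∀ t → Univariate (hBr-1^ t vac)
univariate-hBr-1^ zero    = const ∷ []
univariate-hBr-1^ (suc t) = univariate-hBr-1 (univariate-hBr-1^ t)

coeff₁-h-1-zero : ∀ {p} → Univariate p → coeff₁ (hmode -[1+ 0 ] p) 0 ≡ 0ℚ
coeff₁-h-1-zero                []       = refl
coeff₁-h-1-zero {(a , m) ∷ p} (u ∷ us) = begin
  coeff₁ ((a , incAt 0 m) ∷ hmode -[1+ 0 ] p) 0
    ≡⟨ coeff₁-∷ (hmode -[1+ 0 ] p) 0 (incAt₀-univariate u) ⟩
  δ (expAt 0 (incAt 0 m)) 0 a ℚ.+ coeff₁ (hmode -[1+ 0 ] p) 0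
    ≡⟨ cong₂ ℚ._+_ (cong (λ e → δ e 0 a) (expAt₀-incAt₀ m)) (coeff₁-h-1-zero us) ⟩
  0ℚ ℚ.+ 0ℚ
    ≡⟨⟩
  0ℚ
    ∎

coeff₁-h-1-suc : ∀ {p} n → Univariate p → coeff₁ (hmode -[1+ 0 ] p) (suc n) ≡ coeff₁ p n
coeff₁-h-1-suc                n []       = refl
coeff₁-h-1-suc {(a , m) ∷ p} n (u ∷ us) = begin
  coeff₁ ((a , incAt 0 m) ∷ hmode -[1+ 0 ] p) (suc n)
    ≡⟨ coeff₁-∷ (hmode -[1+ 0 ] p) (suc n) (incAt₀-univariate u) ⟩
  δ (expAt 0 (incAt 0 m)) (suc n) a ℚ.+ coeff₁ (hmode -[1+ 0 ] p) (suc n)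
    ≡⟨ cong₂ ℚ._+_ (cong (λ e → δ e (suc n) a) (expAt₀-incAt₀ m)) (coeff₁-h-1-suc n us) ⟩
  δ (expAt 0 m) n a ℚ.+ coeff₁ p n
    ≡⟨ coeff₁-∷ p n u ⟨
  coeff₁ ((a , m) ∷ p) n
    ∎

coeff₁-deriv₀ : ∀ {p} n → Univariate p → coeff₁ (deriv 0 p) n ≡ fromℕ (suc n) ℚ.* coeff₁ p (suc n)
coeff₁-deriv₀                n []       = sym (ℚP.*-zeroʳ (fromℕ (suc n)))
coeff₁-deriv₀ {(a , m) ∷ p} n (u ∷ us) = begin
  coeff₁ ((fromℕ e ℚ.* a , decAt 0 m) ∷ deriv 0 p) n
    ≡⟨ coeff₁-∷ (deriv 0 p) n (decAt-univariate 0 u) ⟩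
  δ (expAt 0 (decAt 0 m)) n (fromℕ e ℚ.* a) ℚ.+ coeff₁ (deriv 0 p) n
    ≡⟨ cong₂ ℚ._+_ (trans (cong (λ e′ → δ e′ n (fromℕ e ℚ.* a)) (expAt₀-decAt₀ m)) (δ-pred e n a))
                   (coeff₁-deriv₀ n us) ⟩
  fromℕ (suc n) ℚ.* δ e (suc n) a ℚ.+ fromℕ (suc n) ℚ.* coeff₁ p (suc n)
    ≡⟨ ℚP.*-distribˡ-+ (fromℕ (suc n)) (δ e (suc n) a) (coeff₁ p (suc n)) ⟨
  fromℕ (suc n) ℚ.* (δ e (suc n) a ℚ.+ coeff₁ p (suc n))
    ≡⟨ cong (fromℕ (suc n) ℚ.*_) (coeff₁-∷ p (suc n) u) ⟨
  fromℕ (suc n) ℚ.* coeff₁ ((a , m) ∷ p) (suc n)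
    ∎
  where e = expAt 0 m

coeff₁-h1 : ∀ {p} n → Univariate p → coeff₁ (hmode (+ 1) p) n ≡ fromℕ (suc n) ℚ.* coeff₁ p (suc n)
coeff₁-h1 {p} n u = begin
  coeff₁ (hmode (+ 1) p) n                  ≡⟨ coeff-scale (fromℕ 1) (deriv 0 p) (n ∷ []) ⟩
  fromℕ 1 ℚ.* coeff₁ (deriv 0 p) n          ≡⟨ ℚP.*-identityˡ (coeff₁ (deriv 0 p) n) ⟩
  coeff₁ (deriv 0 p) n                      ≡⟨ coeff₁-deriv₀ n u ⟩
  fromℕ (suc n) ℚ.* coeff₁ p (suc n)        ∎

coeff₁-h2+ : ∀ {p} j n → Univariate p → coeff₁ (hmode (+ suc (suc j)) p) n ≡ 0ℚ
coeff₁-h2+ {p} j n u = begin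
  coeff₁ (hmode (+ suc (suc j)) p) n                   ≡⟨ coeff-scale (fromℕ (2 ℕ.+ j)) (deriv (suc j) p) (n ∷ []) ⟩
  fromℕ (2 ℕ.+ j) ℚ.* coeff₁ (deriv (suc j) p) n       ≡⟨ cong (fromℕ (2 ℕ.+ j) ℚ.*_) (deriv-vanishes u) ⟩
  fromℕ (2 ℕ.+ j) ℚ.* 0ℚ                               ≡⟨ ℚP.*-zeroʳ (fromℕ (2 ℕ.+ j)) ⟩
  0ℚ                                                   ∎
  where
  deriv-vanishes : ∀ {p} → Univariate p → coeff₁ (deriv (suc j) p) n ≡ 0ℚ
  deriv-vanishes                []       = refl
  deriv-vanishes {(a , m) ∷ p} (u ∷ us) = begin
    coeff₁ ((fromℕ (expAt (suc j) m) ℚ.* a , decAt (suc j) m) ∷ deriv (suc j) p) n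
      ≡⟨ coeff₁-∷ (deriv (suc j) p) n (decAt-univariate (suc j) u) ⟩
    δ e n (fromℕ (expAt (suc j) m) ℚ.* a) ℚ.+ coeff₁ (deriv (suc j) p) n
      ≡⟨ cong₂ ℚ._+_ killed (deriv-vanishes us) ⟩
    0ℚ ℚ.+ 0ℚ
      ≡⟨⟩
    0ℚ
      ∎
    where
    e = expAt 0 (decAt (suc j) m)
    killed : δ e n (fromℕ (expAt (suc j) m) ℚ.* a) ≡ 0ℚ
    killed rewrite expAt-suc-univariate j u = trans (cong (δ e n) (ℚP.*-zeroˡ a)) (δ-zero e n)

coeff₁-maxLen-zero : ∀ {p} n → Univariate p → maxLen p ≡ 0 → coeff₁ p (suc n) ≡ 0ℚ
coeff₁-maxLen-zero                    n []           _  = refl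
coeff₁-maxLen-zero {(a , []) ∷ p}     n (const ∷ us) eq =
  trans (coeff₁-∷ {a} p (suc n) const) (trans (ℚP.+-identityˡ (coeff₁ p (suc n))) (coeff₁-maxLen-zero {p} n us eq))
coeff₁-maxLen-zero {(a , _ ∷ []) ∷ p} n (pow e ∷ us) eq with subst (1 ℕ.≤_) eq (ℕP.m≤m⊔n 1 (maxLen p))
... | ()

coeff₁-hBr-1 : ∀ {p} n → Univariate p →
               coeff₁ (hBr-1 p) n ≡ coeff₁ (hmode -[1+ 0 ] p) n ℚ.+ c 2 ℚ.* coeff₁ (hmode (+ 1) p) n
coeff₁-hBr-1 {p} n u = begin
  coeff₁ (hBr-1 p) n
    ≡⟨ cong (λ N → coeff₁ (Σp (map (bracketTerm p) (upTo N))) n) (ℕP.+-comm (maxLen p) 2) ⟩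
  coeff₁ (bracketTerm p 0 ⊕ terms≥2 (maxLen p)) n
    ≡⟨ coeff-⊕ (bracketTerm p 0) (terms≥2 (maxLen p)) (n ∷ []) ⟩
  coeff₁ (bracketTerm p 0) n ℚ.+ coeff₁ (terms≥2 (maxLen p)) n
    ≡⟨ cong₂ ℚ._+_ (trans (coeff-scale (c 0) (hmode -[1+ 0 ] p) (n ∷ [])) (ℚP.*-identityˡ (coeff₁ (hmode -[1+ 0 ] p) n)))
                   (coeff₁-terms≥2 (maxLen p) refl) ⟩
  coeff₁ (hmode -[1+ 0 ] p) n ℚ.+ c 2 ℚ.* coeff₁ (hmode (+ 1) p) n
    ∎
  where
  terms≥2 : ℕ → Poly
  terms≥2 N = Σp (map (bracketTerm p) (applyUpTo (2 ℕ.+_) N))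

  terms≥3-vanish : ∀ j → coeff₁ (bracketTerm p (3 ℕ.+ j)) n ≡ 0ℚ
  terms≥3-vanish j = begin
    coeff₁ (bracketTerm p (3 ℕ.+ j)) n                 ≡⟨ coeff-scale (c (3 ℕ.+ j)) (hmode (+ (2 ℕ.+ j)) p) (n ∷ []) ⟩
    c (3 ℕ.+ j) ℚ.* coeff₁ (hmode (+ (2 ℕ.+ j)) p) n   ≡⟨ cong (c (3 ℕ.+ j) ℚ.*_) (coeff₁-h2+ j n u) ⟩
    c (3 ℕ.+ j) ℚ.* 0ℚ                                 ≡⟨ ℚP.*-zeroʳ (c (3 ℕ.+ j)) ⟩
    0ℚ                                                 ∎

  -- For constant p the truncated sum hBr-1 p stops before the h(1) term, which then vanishes anyway.
  coeff₁-terms≥2 : ∀ N → maxLen p ≡ N → coeff₁ (terms≥2 N) n ≡ c 2 ℚ.* coeff₁ (hmode (+ 1) p) n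
  coeff₁-terms≥2 zero    eq = sym (begin
    c 2 ℚ.* coeff₁ (hmode (+ 1) p) n                ≡⟨ cong (c 2 ℚ.*_) (coeff₁-h1 n u) ⟩
    c 2 ℚ.* (fromℕ (suc n) ℚ.* coeff₁ p (suc n))    ≡⟨ cong (λ x → c 2 ℚ.* (fromℕ (suc n) ℚ.* x)) (coeff₁-maxLen-zero n u eq) ⟩
    c 2 ℚ.* (fromℕ (suc n) ℚ.* 0ℚ)                  ≡⟨ cong (c 2 ℚ.*_) (ℚP.*-zeroʳ (fromℕ (suc n))) ⟩
    c 2 ℚ.* 0ℚ                                      ≡⟨⟩
    0ℚ                                              ∎)
  coeff₁-terms≥2 (suc N) _ = begin
    coeff₁ (bracketTerm p 2 ⊕ rest) n
      ≡⟨ coeff-⊕ (bracketTerm p 2) rest (n ∷ []) ⟩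
    coeff₁ (bracketTerm p 2) n ℚ.+ coeff₁ rest n
      ≡⟨ cong₂ ℚ._+_ (coeff-scale (c 2) (hmode (+ 1) p) (n ∷ []))
                     (coeff-Σp-vanish (bracketTerm p) (3 ℕ.+_) N (n ∷ []) terms≥3-vanish) ⟩
    c 2 ℚ.* coeff₁ (hmode (+ 1) p) n ℚ.+ 0ℚ
      ≡⟨ ℚP.+-identityʳ (c 2 ℚ.* coeff₁ (hmode (+ 1) p) n) ⟩
    c 2 ℚ.* coeff₁ (hmode (+ 1) p) n
      ∎
    where rest = Σp (map (bracketTerm p) (applyUpTo (3 ℕ.+_) N))

hBr-1^-coeff : ℕ → ℕ → ℚ
hBr-1^-coeff t n = coeff₁ (hBr-1^ t vac) n

-- c 2 evaluates to 2 r = -1/12; the recurrences below use this conversion silently.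
r : ℚ
r = -[1+ 0 ] / 24

hBr-1^-coeff-suc-zero : ∀ t → hBr-1^-coeff (suc t) 0 ≡ fromℕ 2 ℚ.* r ℚ.* hBr-1^-coeff t 1
hBr-1^-coeff-suc-zero t = begin
  coeff₁ (hBr-1 p) 0
    ≡⟨ coeff₁-hBr-1 0 u ⟩
  coeff₁ (hmode -[1+ 0 ] p) 0 ℚ.+ c 2 ℚ.* coeff₁ (hmode (+ 1) p) 0
    ≡⟨ cong₂ (λ x y → x ℚ.+ c 2 ℚ.* y) (coeff₁-h-1-zero u) (coeff₁-h1 0 u) ⟩
  0ℚ ℚ.+ c 2 ℚ.* (fromℕ 1 ℚ.* coeff₁ p 1)
    ≡⟨ ℚP.+-identityˡ (c 2 ℚ.* (fromℕ 1 ℚ.* coeff₁ p 1)) ⟩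
  c 2 ℚ.* (fromℕ 1 ℚ.* coeff₁ p 1)
    ≡⟨ cong (c 2 ℚ.*_) (ℚP.*-identityˡ (coeff₁ p 1)) ⟩
  fromℕ 2 ℚ.* r ℚ.* coeff₁ p 1
    ∎
  where
  p = hBr-1^ t vac
  u = univariate-hBr-1^ t

hBr-1^-coeff-suc-suc : ∀ t n → hBr-1^-coeff (suc t) (suc n) ≡
                       hBr-1^-coeff t n ℚ.+ fromℕ 2 ℚ.* r ℚ.* (fromℕ (2 ℕ.+ n) ℚ.* hBr-1^-coeff t (2 ℕ.+ n))
hBr-1^-coeff-suc-suc t n = begin
  coeff₁ (hBr-1 p) (suc n)
    ≡⟨ coeff₁-hBr-1 (suc n) u ⟩
  coeff₁ (hmode -[1+ 0 ] p) (suc n) ℚ.+ c 2 ℚ.* coeff₁ (hmode (+ 1) p) (suc n)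
    ≡⟨ cong₂ (λ x y → x ℚ.+ c 2 ℚ.* y) (coeff₁-h-1-suc n u) (coeff₁-h1 (suc n) u) ⟩
  coeff₁ p n ℚ.+ fromℕ 2 ℚ.* r ℚ.* (fromℕ (2 ℕ.+ n) ℚ.* coeff₁ p (2 ℕ.+ n))
    ∎
  where
  p = hBr-1^ t vac
  u = univariate-hBr-1^ t

shift-double : ∀ m k → m ℕ.+ suc k ℕ.+ suc k ≡ suc (suc m) ℕ.+ k ℕ.+ k
shift-double m k = trans (cong (ℕ._+ suc k) (ℕP.+-suc m k)) (cong suc (ℕP.+-suc (m ℕ.+ k) k))

hBr-1^-coeff-vanish : ∀ t m → (∀ k → t ≢ m ℕ.+ k ℕ.+ k) → hBr-1^-coeff t m ≡ 0ℚ
hBr-1^-coeff-vanish zero    zero    off = ⊥-elim (off 0 refl)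
hBr-1^-coeff-vanish zero    (suc m) off = refl
hBr-1^-coeff-vanish (suc t) zero    off = begin
  hBr-1^-coeff (suc t) 0                   ≡⟨ hBr-1^-coeff-suc-zero t ⟩
  fromℕ 2 ℚ.* r ℚ.* hBr-1^-coeff t 1       ≡⟨ cong (fromℕ 2 ℚ.* r ℚ.*_) (hBr-1^-coeff-vanish t 1 off′) ⟩
  fromℕ 2 ℚ.* r ℚ.* 0ℚ                     ≡⟨⟩
  0ℚ                                       ∎
  where
  off′ : ∀ k → t ≢ 1 ℕ.+ k ℕ.+ k
  off′ k eq = off (suc k) (cong suc (trans eq (sym (ℕP.+-suc k k))))
hBr-1^-coeff-vanish (suc t) (suc m) off = begin
  hBr-1^-coeff (suc t) (suc m)
    ≡⟨ hBr-1^-coeff-suc-suc t m ⟩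
  hBr-1^-coeff t m ℚ.+ fromℕ 2 ℚ.* r ℚ.* (fromℕ (2 ℕ.+ m) ℚ.* hBr-1^-coeff t (2 ℕ.+ m))
    ≡⟨ cong₂ (λ x y → x ℚ.+ fromℕ 2 ℚ.* r ℚ.* (fromℕ (2 ℕ.+ m) ℚ.* y))
             (hBr-1^-coeff-vanish t m off₀) (hBr-1^-coeff-vanish t (2 ℕ.+ m) off₂) ⟩
  0ℚ ℚ.+ fromℕ 2 ℚ.* r ℚ.* (fromℕ (2 ℕ.+ m) ℚ.* 0ℚ)
    ≡⟨ cong (λ x → 0ℚ ℚ.+ fromℕ 2 ℚ.* r ℚ.* x) (ℚP.*-zeroʳ (fromℕ (2 ℕ.+ m))) ⟩
  0ℚ
    ∎
  where
  off₀ : ∀ k → t ≢ m ℕ.+ k ℕ.+ k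
  off₀ k eq = off k (cong suc eq)
  off₂ : ∀ k → t ≢ 2 ℕ.+ m ℕ.+ k ℕ.+ k
  off₂ k eq = off (suc k) (cong suc (trans eq (sym (shift-double m k))))

hBr-1^-coeff-below : ∀ t m → t ℕ.< m → hBr-1^-coeff t m ≡ 0ℚ
hBr-1^-coeff-below t m t<m = hBr-1^-coeff-vanish t m λ k eq →
  ℕP.<-irrefl eq (ℕP.<-≤-trans t<m (ℕP.≤-trans (ℕP.m≤m+n m k) (ℕP.m≤m+n (m ℕ.+ k) k)))

-- weight m k = (m + 2k)! / (m! k!) by weight-factorial; the recursion is the recurrence of
-- hBr-1^-coeff along the diagonal t = m + 2k.
weight : ℕ → ℕ → ℕ
weight m       zero    = 1
weight zero    (suc k) = 2 ℕ.* weight 1 k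
weight (suc m) (suc k) = weight m (suc k) ℕ.+ 2 ℕ.* (2 ℕ.+ m) ℕ.* weight (2 ℕ.+ m) k

hBr-1^-coeff-diagonal : ∀ k m → hBr-1^-coeff (m ℕ.+ k ℕ.+ k) m ≡ fromℕ (weight m k) ℚ.* r ^ k
hBr-1^-coeff-diagonal zero zero = refl
hBr-1^-coeff-diagonal zero (suc m) = begin
  hBr-1^-coeff (suc t) (suc m)
    ≡⟨ hBr-1^-coeff-suc-suc t m ⟩
  hBr-1^-coeff t m ℚ.+ fromℕ 2 ℚ.* r ℚ.* (fromℕ (2 ℕ.+ m) ℚ.* hBr-1^-coeff t (2 ℕ.+ m))
    ≡⟨ cong₂ (λ x y → x ℚ.+ fromℕ 2 ℚ.* r ℚ.* (fromℕ (2 ℕ.+ m) ℚ.* y))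
             (hBr-1^-coeff-diagonal 0 m) (hBr-1^-coeff-below t (2 ℕ.+ m) t<2+m) ⟩
  1ℚ ℚ.+ fromℕ 2 ℚ.* r ℚ.* (fromℕ (2 ℕ.+ m) ℚ.* 0ℚ)
    ≡⟨ cong (λ x → 1ℚ ℚ.+ fromℕ 2 ℚ.* r ℚ.* x) (ℚP.*-zeroʳ (fromℕ (2 ℕ.+ m))) ⟩
  1ℚ
    ∎
  where
  t = m ℕ.+ 0 ℕ.+ 0
  t<2+m : t ℕ.< 2 ℕ.+ m
  t<2+m rewrite ℕP.+-identityʳ m | ℕP.+-identityʳ m = ℕP.m<n⇒m<1+n (ℕP.n<1+n m)
hBr-1^-coeff-diagonal (suc k) zero = begin
  hBr-1^-coeff (suc (k ℕ.+ suc k)) 0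
    ≡⟨ hBr-1^-coeff-suc-zero (k ℕ.+ suc k) ⟩
  fromℕ 2 ℚ.* r ℚ.* hBr-1^-coeff (k ℕ.+ suc k) 1
    ≡⟨ cong (λ t → fromℕ 2 ℚ.* r ℚ.* hBr-1^-coeff t 1) (ℕP.+-suc k k) ⟩
  fromℕ 2 ℚ.* r ℚ.* hBr-1^-coeff (1 ℕ.+ k ℕ.+ k) 1
    ≡⟨ cong (fromℕ 2 ℚ.* r ℚ.*_) (hBr-1^-coeff-diagonal k 1) ⟩
  fromℕ 2 ℚ.* r ℚ.* (fromℕ w ℚ.* r ^ k)
    ≡⟨ solve 4 (λ x r w s → x :* r :* (w :* s) := x :* w :* (r :* s)) refl (fromℕ 2) r (fromℕ w) (r ^ k) ⟩
  fromℕ 2 ℚ.* fromℕ w ℚ.* r ^ suc k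
    ≡⟨ cong (ℚ._* r ^ suc k) (fromℕ-* 2 w) ⟨
  fromℕ (2 ℕ.* w) ℚ.* r ^ suc k
    ∎
  where
  open +-*-Solver
  w = weight 1 k
hBr-1^-coeff-diagonal (suc k) (suc m) = begin
  hBr-1^-coeff (suc t) (suc m)
    ≡⟨ hBr-1^-coeff-suc-suc t m ⟩
  hBr-1^-coeff t m ℚ.+ fromℕ 2 ℚ.* r ℚ.* (fromℕ (2 ℕ.+ m) ℚ.* hBr-1^-coeff t (2 ℕ.+ m))
    ≡⟨ cong₂ (λ x y → x ℚ.+ fromℕ 2 ℚ.* r ℚ.* (fromℕ (2 ℕ.+ m) ℚ.* y))
             (hBr-1^-coeff-diagonal (suc k) m)
             (trans (cong (λ t → hBr-1^-coeff t (2 ℕ.+ m)) (shift-double m k)) (hBr-1^-coeff-diagonal k (2 ℕ.+ m))) ⟩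
  fromℕ A ℚ.* r ^ suc k ℚ.+ fromℕ 2 ℚ.* r ℚ.* (fromℕ (2 ℕ.+ m) ℚ.* (fromℕ B ℚ.* r ^ k))
    ≡⟨ solve 6 (λ a x y b r s → a :* (r :* s) :+ x :* r :* (y :* (b :* s)) := (a :+ x :* y :* b) :* (r :* s))
               refl (fromℕ A) (fromℕ 2) (fromℕ (2 ℕ.+ m)) (fromℕ B) r (r ^ k) ⟩
  (fromℕ A ℚ.+ fromℕ 2 ℚ.* fromℕ (2 ℕ.+ m) ℚ.* fromℕ B) ℚ.* r ^ suc k
    ≡⟨ cong (ℚ._* r ^ suc k) fromℕ-weight ⟨
  fromℕ (A ℕ.+ 2 ℕ.* (2 ℕ.+ m) ℕ.* B) ℚ.* r ^ suc k
    ∎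
  where
  open +-*-Solver
  t = m ℕ.+ suc k ℕ.+ suc k
  A = weight m (suc k)
  B = weight (2 ℕ.+ m) k
  fromℕ-weight : fromℕ (A ℕ.+ 2 ℕ.* (2 ℕ.+ m) ℕ.* B) ≡ fromℕ A ℚ.+ fromℕ 2 ℚ.* fromℕ (2 ℕ.+ m) ℚ.* fromℕ B
  fromℕ-weight = begin
    fromℕ (A ℕ.+ 2 ℕ.* (2 ℕ.+ m) ℕ.* B)                    ≡⟨ fromℕ-+ A (2 ℕ.* (2 ℕ.+ m) ℕ.* B) ⟩
    fromℕ A ℚ.+ fromℕ (2 ℕ.* (2 ℕ.+ m) ℕ.* B)              ≡⟨ cong (fromℕ A ℚ.+_) (fromℕ-* (2 ℕ.* (2 ℕ.+ m)) B) ⟩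
    fromℕ A ℚ.+ fromℕ (2 ℕ.* (2 ℕ.+ m)) ℚ.* fromℕ B        ≡⟨ cong (λ x → fromℕ A ℚ.+ x ℚ.* fromℕ B) (fromℕ-* 2 (2 ℕ.+ m)) ⟩
    fromℕ A ℚ.+ fromℕ 2 ℚ.* fromℕ (2 ℕ.+ m) ℚ.* fromℕ B   ∎

weight-factorial : ∀ k m → weight m k ℕ.* (k ! ℕ.* m !) ≡ (m ℕ.+ k ℕ.+ k) !
weight-factorial zero m = begin
  1 ℕ.* (1 ℕ.* m !)     ≡⟨ trans (ℕP.*-identityˡ (1 ℕ.* m !)) (ℕP.*-identityˡ (m !)) ⟩
  m !                   ≡⟨ cong _! (trans (ℕP.+-identityʳ (m ℕ.+ 0)) (ℕP.+-identityʳ m)) ⟨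
  (m ℕ.+ 0 ℕ.+ 0) !     ∎
weight-factorial (suc k) zero = begin
  2 ℕ.* w ℕ.* (suc k ℕ.* k ! ℕ.* 1)            ≡⟨ regroup w k (k !) ⟩
  suc (suc (k ℕ.+ k)) ℕ.* (w ℕ.* (k ! ℕ.* 1))  ≡⟨ cong (suc (suc (k ℕ.+ k)) ℕ.*_) (weight-factorial k 1) ⟩
  suc (suc (k ℕ.+ k)) !                        ≡⟨ cong (λ n → suc n !) (ℕP.+-suc k k) ⟨
  suc (k ℕ.+ suc k) !                          ∎
  where
  w = weight 1 k
  regroup : ∀ w k f → 2 ℕ.* w ℕ.* (suc k ℕ.* f ℕ.* 1) ≡ suc (suc (k ℕ.+ k)) ℕ.* (w ℕ.* (f ℕ.* 1))
  regroup = ℕ-Solver.solve-∀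
weight-factorial (suc k) (suc m) = begin
  (A ℕ.+ 2 ℕ.* (2 ℕ.+ m) ℕ.* B) ℕ.* (suc k ℕ.* k ! ℕ.* (suc m ℕ.* m !))
    ≡⟨ regroup A B (k !) (m !) m k ⟩
  suc m ℕ.* (A ℕ.* (suc k ! ℕ.* m !)) ℕ.+ 2 ℕ.* suc k ℕ.* (B ℕ.* (k ! ℕ.* (2 ℕ.+ m) !))
    ≡⟨ cong₂ (λ x y → suc m ℕ.* x ℕ.+ 2 ℕ.* suc k ℕ.* y) (weight-factorial (suc k) m)
             (trans (weight-factorial k (2 ℕ.+ m)) (cong _! (sym (shift-double m k)))) ⟩
  suc m ℕ.* F ℕ.+ 2 ℕ.* suc k ℕ.* F
    ≡⟨ collect m k F ⟩
  suc (m ℕ.+ suc k ℕ.+ suc k) ℕ.* F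
    ∎
  where
  A = weight m (suc k)
  B = weight (2 ℕ.+ m) k
  F = (m ℕ.+ suc k ℕ.+ suc k) !
  regroup : ∀ A B f g m k → (A ℕ.+ 2 ℕ.* (2 ℕ.+ m) ℕ.* B) ℕ.* (suc k ℕ.* f ℕ.* (suc m ℕ.* g)) ≡
            suc m ℕ.* (A ℕ.* (suc k ℕ.* f ℕ.* g)) ℕ.+ 2 ℕ.* suc k ℕ.* (B ℕ.* (f ℕ.* ((2 ℕ.+ m) ℕ.* (suc m ℕ.* g))))
  regroup = ℕ-Solver.solve-∀
  collect : ∀ m k F → suc m ℕ.* F ℕ.+ 2 ℕ.* suc k ℕ.* F ≡ suc (m ℕ.+ suc k ℕ.+ suc k) ℕ.* F
  collect = ℕ-Solver.solve-∀

binomial-factorial : ∀ {n k} → k ℕ.≤ n → (n C k) ℕ.* (k ! ℕ.* (n ℕ.∸ k) !) ≡ n !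
binomial-factorial {n} {k} k≤n =
  trans (cong (ℕ._* (k ! ℕ.* (n ℕ.∸ k) !)) (nCk≡n!/k![n-k]! k≤n)) (m/n*n≡m (k![n∸k]!∣n! k≤n))
  where instance _ = k ℕP.!* (n ℕ.∸ k) !≢0

diagonal-split : ∀ n k → suc n ℕ.+ k ℕ.+ k ≡ n ℕ.+ (1 ℕ.+ 2 ℕ.* k)
diagonal-split = ℕ-Solver.solve-∀

diagonal-∸ : ∀ n k → suc n ℕ.+ k ℕ.+ k ℕ.∸ (1 ℕ.+ 2 ℕ.* k) ≡ n
diagonal-∸ n k = trans (cong (ℕ._∸ (1 ℕ.+ 2 ℕ.* k)) (diagonal-split n k)) (ℕP.m+n∸n≡m n (1 ℕ.+ 2 ℕ.* k))

double-injective : ∀ m {k l} → m ℕ.+ k ℕ.+ k ≡ m ℕ.+ l ℕ.+ l → k ≡ l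
double-injective m {k} {l} eq = ℕP.*-cancelˡ-≡ k l 2 (begin
  2 ℕ.* k   ≡⟨ twice k ⟩
  k ℕ.+ k   ≡⟨ ℕP.+-cancelˡ-≡ m (k ℕ.+ k) (l ℕ.+ l) (trans (sym (ℕP.+-assoc m k k)) (trans eq (ℕP.+-assoc m l l))) ⟩
  l ℕ.+ l   ≡⟨ twice l ⟨
  2 ℕ.* l   ∎)
  where
  twice : ∀ k → 2 ℕ.* k ≡ k ℕ.+ k
  twice k = cong (k ℕ.+_) (ℕP.+-identityʳ k)

binomial-weight : ∀ n k → ((suc n ℕ.+ k ℕ.+ k) C (1 ℕ.+ 2 ℕ.* k)) ℕ.* (1 ℕ.+ 2 ℕ.* k) ! ≡
                          suc n ℕ.* weight (suc n) k ℕ.* k !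
binomial-weight n k = ℕP.*-cancelʳ-≡ _ _ (n !) {{n ℕP.!≢0}} (begin
  (t C j) ℕ.* j ! ℕ.* n !                       ≡⟨ ℕP.*-assoc (t C j) (j !) (n !) ⟩
  (t C j) ℕ.* (j ! ℕ.* n !)                     ≡⟨ cong (λ x → (t C j) ℕ.* (j ! ℕ.* x !)) (diagonal-∸ n k) ⟨
  (t C j) ℕ.* (j ! ℕ.* (t ℕ.∸ j) !)             ≡⟨ binomial-factorial j≤t ⟩
  t !                                           ≡⟨ weight-factorial k (suc n) ⟨
  weight (suc n) k ℕ.* (k ! ℕ.* suc n !)        ≡⟨ regroup (suc n) (weight (suc n) k) (k !) (n !) ⟨
  suc n ℕ.* weight (suc n) k ℕ.* k ! ℕ.* n !    ∎)
  where
  t = suc n ℕ.+ k ℕ.+ k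
  j = 1 ℕ.+ 2 ℕ.* k
  j≤t : j ℕ.≤ t
  j≤t = subst (j ℕ.≤_) (sym (diagonal-split n k)) (ℕP.m≤n+m j n)
  regroup : ∀ s w f g → s ℕ.* w ℕ.* f ℕ.* g ≡ w ℕ.* (f ℕ.* (s ℕ.* g))
  regroup = ℕ-Solver.solve-∀

r^-fraction : ∀ k → r ^ k ≡ ((-[1+ 0 ] ℤ.^ k) / (24 ℕ.^ k)) {{ℕP.m^n≢0 24 k}}
r^-fraction zero    = refl
r^-fraction (suc k) =
  trans (cong (r ℚ.*_) (r^-fraction k)) (/-*-/ -[1+ 0 ] 24 (-[1+ 0 ] ℤ.^ k) (24 ℕ.^ k) {{_}} {{ℕP.m^n≢0 24 k}})

rhsCoeff-diagonal : ∀ n k → fromℕ (suc n) ℚ.* (fromℕ (weight (suc n) k) ℚ.* r ^ k) ≡ rhsCoeff (suc n ℕ.+ k ℕ.+ k) k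
rhsCoeff-diagonal n k = begin
  fromℕ (suc n) ℚ.* (fromℕ w ℚ.* r ^ k)          ≡⟨ ℚP.*-assoc (fromℕ (suc n)) (fromℕ w) (r ^ k) ⟨
  fromℕ (suc n) ℚ.* fromℕ w ℚ.* r ^ k            ≡⟨ cong₂ ℚ._*_ (sym (fromℕ-* (suc n) w)) (r^-fraction k) ⟩
  fromℕ (suc n ℕ.* w) ℚ.* (σ / D)                ≡⟨ fromℕ-*-/ (suc n ℕ.* w) σ D ⟩
  (+ (suc n ℕ.* w) ℤ.* σ) / D                    ≡⟨ /-cancel (suc n ℕ.* w) (k !) σ D ⟨
  (+ (suc n ℕ.* w ℕ.* k !) ℤ.* σ) / (k ! ℕ.* D)  ≡⟨ cong (λ x → (+ x ℤ.* σ) / (k ! ℕ.* D)) (binomial-weight n k) ⟨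
  rhsCoeff (suc n ℕ.+ k ℕ.+ k) k                 ∎
  where
  w = weight (suc n) k
  σ = -[1+ 0 ] ℤ.^ k
  D = 24 ℕ.^ k
  instance
    _ : NonZero D
    _ = ℕP.m^n≢0 24 k
    _ : NonZero (k ! ℕ.* D)
    _ = ℕP.m*n≢0 (k !) D {{k ℕP.!≢0}}

rhsCoeff-vanish : ∀ t k → t ℕ.< 1 ℕ.+ 2 ℕ.* k → rhsCoeff t k ≡ 0ℚ
rhsCoeff-vanish t k t<j = trans (cong (λ x → (+ (x ℕ.* j !) ℤ.* σ) / D) (k>n⇒nCk≡0 t<j)) (ℚP.0/n≡0 D)
  where
  j = 1 ℕ.+ 2 ℕ.* k
  σ = -[1+ 0 ] ℤ.^ k
  D = k ! ℕ.* 24 ℕ.^ k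
  instance
    _ : NonZero D
    _ = ℕP.m*n≢0 (k !) (24 ℕ.^ k) {{k ℕP.!≢0}} {{ℕP.m^n≢0 24 k}}

rhsTerm : ℕ → ℕ → Poly
rhsTerm t k = scale (rhsCoeff t k) (h-1^ (t ℕ.∸ (1 ℕ.+ 2 ℕ.* k)))

univariate-rhs : ∀ t → Univariate (rhs t)
univariate-rhs t = univariate-Σp {rhsTerm t} (λ k → univariate-scale (rhsCoeff t k) (pow _ ∷ [])) (upTo (suc t))

coeff₁-rhsTerm : ∀ t k n → coeff₁ (rhsTerm t k) n ≡ rhsCoeff t k ℚ.* δ (t ℕ.∸ (1 ℕ.+ 2 ℕ.* k)) n 1ℚ
coeff₁-rhsTerm t k n = begin
  coeff₁ (rhsTerm t k) n               ≡⟨ coeff-scale (rhsCoeff t k) (h-1^ e) (n ∷ []) ⟩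
  rhsCoeff t k ℚ.* coeff₁ (h-1^ e) n   ≡⟨ cong (rhsCoeff t k ℚ.*_) (trans (coeff₁-∷ [] n (pow e)) (ℚP.+-identityʳ (δ e n 1ℚ))) ⟩
  rhsCoeff t k ℚ.* δ e n 1ℚ            ∎
  where e = t ℕ.∸ (1 ℕ.+ 2 ℕ.* k)

coeff₁-rhsTerm-off : ∀ t k n → t ≢ suc n ℕ.+ k ℕ.+ k → coeff₁ (rhsTerm t k) n ≡ 0ℚ
coeff₁-rhsTerm-off t k n off with 1 ℕ.+ 2 ℕ.* k ℕ.≤? t
... | yes j≤t = begin
  coeff₁ (rhsTerm t k) n           ≡⟨ coeff₁-rhsTerm t k n ⟩
  rhsCoeff t k ℚ.* δ (t ℕ.∸ j) n 1ℚ ≡⟨ cong (rhsCoeff t k ℚ.*_) (δ-≢ 1ℚ t∸j≢n) ⟩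
  rhsCoeff t k ℚ.* 0ℚ              ≡⟨ ℚP.*-zeroʳ (rhsCoeff t k) ⟩
  0ℚ                               ∎
  where
  j = 1 ℕ.+ 2 ℕ.* k
  t∸j≢n : t ℕ.∸ j ≢ n
  t∸j≢n eq = off (begin
    t                 ≡⟨ ℕP.m∸n+n≡m j≤t ⟨
    t ℕ.∸ j ℕ.+ j     ≡⟨ cong (ℕ._+ j) eq ⟩
    n ℕ.+ j           ≡⟨ diagonal-split n k ⟨
    suc n ℕ.+ k ℕ.+ k ∎)
... | no j≰t = begin
  coeff₁ (rhsTerm t k) n           ≡⟨ coeff₁-rhsTerm t k n ⟩
  rhsCoeff t k ℚ.* δ (t ℕ.∸ j) n 1ℚ ≡⟨ cong (ℚ._* δ (t ℕ.∸ j) n 1ℚ) (rhsCoeff-vanish t k (ℕP.≰⇒> j≰t)) ⟩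
  0ℚ ℚ.* δ (t ℕ.∸ j) n 1ℚ          ≡⟨ ℚP.*-zeroˡ (δ (t ℕ.∸ j) n 1ℚ) ⟩
  0ℚ                               ∎
  where j = 1 ℕ.+ 2 ℕ.* k

coeff₁-rhsTerm-diagonal : ∀ n k → coeff₁ (rhsTerm (suc n ℕ.+ k ℕ.+ k) k) n ≡ rhsCoeff (suc n ℕ.+ k ℕ.+ k) k
coeff₁-rhsTerm-diagonal n k = begin
  coeff₁ (rhsTerm t k) n                           ≡⟨ coeff₁-rhsTerm t k n ⟩
  rhsCoeff t k ℚ.* δ (t ℕ.∸ (1 ℕ.+ 2 ℕ.* k)) n 1ℚ  ≡⟨ cong (λ e → rhsCoeff t k ℚ.* δ e n 1ℚ) (diagonal-∸ n k) ⟩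
  rhsCoeff t k ℚ.* δ n n 1ℚ                        ≡⟨ cong (rhsCoeff t k ℚ.*_) (δ-refl n 1ℚ) ⟩
  rhsCoeff t k ℚ.* 1ℚ                              ≡⟨ ℚP.*-identityʳ (rhsCoeff t k) ⟩
  rhsCoeff t k                                     ∎
  where t = suc n ℕ.+ k ℕ.+ k

coeff₁-rhs : ∀ t n → coeff₁ (rhs t) n ≡ fromℕ (suc n) ℚ.* hBr-1^-coeff t (suc n)
coeff₁-rhs t n with anyUpTo? (λ k → t ℕ.≟ suc n ℕ.+ k ℕ.+ k) (suc t)
coeff₁-rhs .(suc n ℕ.+ k ℕ.+ k) n | yes (k , k<t , refl) = begin
  coeff₁ (rhs t) n                                          ≡⟨ coeff-Σp-single (rhsTerm t) id (suc t) (n ∷ []) k k<t others ⟩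
  coeff₁ (rhsTerm t k) n                                    ≡⟨ coeff₁-rhsTerm-diagonal n k ⟩
  rhsCoeff t k                                              ≡⟨ rhsCoeff-diagonal n k ⟨
  fromℕ (suc n) ℚ.* (fromℕ (weight (suc n) k) ℚ.* r ^ k)  ≡⟨ cong (fromℕ (suc n) ℚ.*_) (hBr-1^-coeff-diagonal k (suc n)) ⟨
  fromℕ (suc n) ℚ.* hBr-1^-coeff t (suc n)                  ∎
  where
  t = suc n ℕ.+ k ℕ.+ k
  others : ∀ i → i ≢ k → coeff₁ (rhsTerm t i) n ≡ 0ℚ
  others i i≢k = coeff₁-rhsTerm-off t i n (λ eq → i≢k (double-injective (suc n) (sym eq)))
... | no ∄k = begin
  coeff₁ (rhs t) n                           ≡⟨ coeff-Σp-vanish (rhsTerm t) id (suc t) (n ∷ []) (λ k → coeff₁-rhsTerm-off t k n (off k)) ⟩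
  0ℚ                                         ≡⟨ ℚP.*-zeroʳ (fromℕ (suc n)) ⟨
  fromℕ (suc n) ℚ.* 0ℚ                       ≡⟨ cong (fromℕ (suc n) ℚ.*_) (hBr-1^-coeff-vanish t (suc n) off) ⟨
  fromℕ (suc n) ℚ.* hBr-1^-coeff t (suc n)   ∎
  where
  off : ∀ k → t ≢ suc n ℕ.+ k ℕ.+ k
  off k eq = ∄k (k , ℕ.s≤s (subst (k ℕ.≤_) (sym eq) (ℕP.m≤n+m k (suc n ℕ.+ k))) , eq)

lemma3p3 : (t : ℕ) → t % 2 ≡ 1 → hmode (+ 1) (hBr-1^ t vac) ≈P rhs t
lemma3p3 t _ = univariate-≈P (univariate-h+ 1 (univariate-hBr-1^ t)) (univariate-rhs t) λ n → begin
  coeff₁ (hmode (+ 1) (hBr-1^ t vac)) n      ≡⟨ coeff₁-h1 n (univariate-hBr-1^ t) ⟩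
  fromℕ (suc n) ℚ.* hBr-1^-coeff t (suc n)  ≡⟨ coeff₁-rhs t n ⟨
  coeff₁ (rhs t) n                           ∎
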